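{- Let $d\ge 0$ be an integer, let $n=3^d$, and let $D_n=\langle a,b\mid a^n=b^2=(ab)^2=1\rangle=\{1,a,\dots,a^{n-1},b,ab,\dots,a^{n-1}b\}$ be the dihedral group of order $2n$. Let $C=\{a^{3^i}b\mid 0\le i\le d\}\subseteq D_n$ and $G=\mathrm{Cay}(D_n,C)$. Let \[M=\{a^{i}\mid 1\le i\le n-1,\ [i]_3=1\}\cup\{a^{i}b\mid 1\le i\le n-1,\ [i]_3=2\}\cup\{1,b\}.\] Then $|M|=n+1$ and the subgraph of $G$ induced by $M$ is a matching. As a consequence, $\sigma(G)=1$.
   Context: For a positive integer $m$, $[m]_3\in\{1,2\}$ denotes the right-most nonzero digit of $m$ in base $3$. For a group $\Gamma$ and $C\subseteq\Gamma$, $\mathrm{Cay}(\Gamma,C)$ is the simple undirected graph on $\Gamma$ in which $\{x,y\}$ is an edge iff $x^{ -1}y\in C$ (or $y^{ -1}x\in C$). For a graph $G=(V,E)$, $\alpha(G)$ is the independence number, $\Delta(H)$ the maximum degree, $G[K]$ the subgraph induced by $K\subseteq V$, and the sensitivity $\sigma(G)$ is the minimum of $\Delta(G[K])$ over all $K\subseteq V$ with $|K|>\alpha(G)$. -}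

module Defs where

open import Data.Bool using (Bool; true; false; _∧_; _∨_; not; if_then_else_)
open import Data.Nat using (ℕ; zero; suc; _+_; _*_; _∸_; _^_; _≤_; _<_; _%_; _/_; NonZero)
open import Data.Nat.Properties using (m^n≢0)
open import Data.Nat.DivMod using (_mod_)
open import Data.Fin using (Fin; toℕ; remQuot)
open import Data.Fin.Subset using (Subset; _∈_; _∩_; ∣_∣)
open import Data.Vec using (tabulate)
open import Data.List using (List; upTo)
open import Data.Bool.ListAction using (any)
open import Data.Product using (_×_; _,_; ∃; ∃-syntax; Σ-syntax)
open import Data.Sum using (_⊎_)
open import Relation.Binary.PropositionalEquality using (_≡_)
open import Relation.Nullary using (¬_)
open import Relation.Nullary.Decidable using (⌊_⌋)
import Data.Nat as ℕ
import Data.Fin as F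

-- Right-most nonzero base-3 digit  [m]₃  (meaningful for m ≥ 1).
-- Strip factors of 3 (fuel m suffices for m ≥ 1), then take m mod 3.

digit3-go : ℕ → ℕ → ℕ
digit3-go zero    m = m % 3
digit3-go (suc f) m with m % 3
... | zero  = digit3-go f (m / 3)
... | suc r = suc r

[_]₃ : ℕ → ℕ
[ m ]₃ = digit3-go m m

Graph : ℕ → Set
Graph N = Fin N → Fin N → Bool

module _ {N : ℕ} (G : Graph N) where

  nbhd : Fin N → Subset N
  nbhd u = tabulate (G u)

  degIn : Subset N → Fin N → ℕ
  degIn K u = ∣ K ∩ nbhd u ∣

  Independent : Subset N → Set
  Independent S = ∀ u v → u ∈ S → v ∈ S → G u v ≡ false

  IsIndependenceNumber : ℕ → Set
  IsIndependenceNumber a =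
    (Σ[ S ∈ Subset N ] (Independent S × ∣ S ∣ ≡ a)) ×
    (∀ S → Independent S → ∣ S ∣ ≤ a)

  IsMaxDegIn : Subset N → ℕ → Set
  IsMaxDegIn K t =
    (∀ u → u ∈ K → degIn K u ≤ t) ×
    ((t ≡ 0) ⊎ (Σ[ u ∈ Fin N ] (u ∈ K × degIn K u ≡ t)))

  IsSensitivity : ℕ → Set
  IsSensitivity s = Σ[ a ∈ ℕ ] (IsIndependenceNumber a ×
    ((Σ[ K ∈ Subset N ] (a < ∣ K ∣ × IsMaxDegIn K s)) ×
     (∀ K t → a < ∣ K ∣ → IsMaxDegIn K t → s ≤ t)))

-- Dihedral group D_n = ⟨a, b | aⁿ = b² = (ab)² = 1⟩ of order 2n.
-- Element (e , i) with e : Fin 2, i : Fin n stands for aⁱ bᵉ.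
-- (aⁱ bᵉ)(aʲ bᶠ) = a^(i + (-1)ᵉ j) b^(e+f).

module Dihedral (n : ℕ) .{{_ : NonZero n}} where

  D : Set
  D = Fin 2 × Fin n

  _⊕_ : Fin 2 → Fin 2 → Fin 2
  F.zero ⊕ f = f
  F.suc F.zero ⊕ F.zero = F.suc F.zero
  F.suc F.zero ⊕ F.suc F.zero = F.zero

  signed : Fin 2 → Fin n → ℕ
  signed F.zero j = toℕ j
  signed (F.suc F.zero) j = n ∸ toℕ j

  _·_ : D → D → D
  (e , i) · (f , j) = (e ⊕ f , (toℕ i + signed e j) mod n)

  _⁻¹ : D → D
  (F.zero , i) ⁻¹ = (F.zero , (n ∸ toℕ i) mod n)
  (F.suc F.zero , i) ⁻¹ = (F.suc F.zero , i)

  rot : ℕ → D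
  rot i = (F.zero , i mod n)

  rotb : ℕ → D
  rotb i = (F.suc F.zero , i mod n)

  _≟D_ : D → D → Bool
  (e , i) ≟D (f , j) = ⌊ e F.≟ f ⌋ ∧ ⌊ i F.≟ j ⌋

  cayAdj : (D → Bool) → D → D → Bool
  cayAdj C x y = not (x ≟D y) ∧ (C ((x ⁻¹) · y) ∨ C ((y ⁻¹) · x))

  vtx : Fin (2 * n) → D
  vtx = remQuot n

module Thm (d : ℕ) where
  n : ℕ
  n = 3 ^ d

  instance
    n-nonZero : NonZero n
    n-nonZero = m^n≢0 3 d

  open Dihedral n public

  inC : D → Bool
  inC x = any (λ i → x ≟D rotb (3 ^ i)) (upTo (suc d))

  G : Graph (2 * n)
  G u v = cayAdj inC (vtx u) (vtx v)

  inM : D → Bool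
  inM (F.zero , i) = ⌊ toℕ i ℕ.≟ 0 ⌋ ∨ ⌊ [ toℕ i ]₃ ℕ.≟ 1 ⌋
  inM (F.suc F.zero , i) = ⌊ toℕ i ℕ.≟ 0 ⌋ ∨ ⌊ [ toℕ i ]₃ ℕ.≟ 2 ⌋

  M : Subset (2 * n)
  M = tabulate (λ u → inM (vtx u))

{-# OPTIONS --safe #-}
module Submission where

-- Every positive i is 3ᵛ(3q + r) with r = [i]₃ ∈ {1, 2}.  In G, aⁱ is adjacent to aʲb exactly
-- when j ≡ i + 3ᵏ (mod n) for some k ≤ d, and there are no other edges.  If i = 3ᵛ(3q + 1),
-- adding 3ᵏ keeps the trailing digit 1 in position v when k > v (also after reducing mod n,
-- as 3ᵛ⁺¹ ∣ n) and creates a trailing digit 1 in position k when k < v; only k = v gives a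
-- reflection in M, namely a^(3ᵛ(3q + 2)) b.  Together with the edge 1 ~ b this makes G[M] a
-- perfect matching on n + 1 vertices.  The n rotations are independent, while any set of more
-- than n vertices contains a pair aⁱ, aⁱb, adjacent because b = a^(3ᵈ) b ∈ C.  Hence α(G) = n,
-- every K with |K| > α(G) has Δ(G[K]) ≥ 1, and K = M attains 1.

open import Defs
import Data.Nat as ℕ
open import Data.Nat
  using (ℕ; zero; suc; _+_; _*_; _∸_; _^_; _≤_; _<_; _%_; _/_; NonZero; >-nonZero; z≤n; s≤s; s≤s⁻¹)
open import Data.Nat.Properties
open import Data.Nat.DivMod
open import Data.Nat.Divisibility using (_∣_; divides; ∣-trans; ∣-refl)
open import Data.Nat.Induction using (<-rec)
open import Data.Nat.Solver using (module +-*-Solver)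
open import Data.Bool using (Bool; true; false; T; not; _∨_)
open import Data.Bool.Properties using (T-∧; T-∨; T-≡; ∨-idem)
open import Data.Empty using (⊥-elim)
open import Data.Fin using (Fin; toℕ; fromℕ<; combine; _↑ˡ_; _↑ʳ_)
open import Data.Fin.Patterns using (0F; 1F)
open import Data.Fin.Properties using (toℕ-fromℕ<; toℕ-injective; toℕ<n; remQuot-combine; combine-remQuot)
open import Data.Fin.Subset using (Subset; _∈_; _∩_; _∪_; ∣_∣; ⊤; ⊥; ⁅_⁆; Nonempty)
open import Data.Fin.Subset.Properties
  using (∣p∣≤n; ∣⊥∣≡0; ∣⊤∣≡n; ∣⁅x⁆∣≡1; x∈⁅y⁆⇒x≡y; x∈⁅y⁆⇔x≡y; ⊆-antisym; ∈⊤; x∈p∩q⁺; x∈p∩q⁻; x∈p∪q⁺;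
         p⊆q⇒∣p∣≤∣q∣; Empty-unique; nonempty?)
open import Data.List using (upTo)
open import Data.List.Membership.Propositional using (find; lose)
open import Data.List.Membership.Propositional.Properties using (∈-upTo⁺; ∈-upTo⁻)
open import Data.List.Relation.Unary.Any using (satisfied)
open import Data.List.Relation.Unary.Any.Properties using (any⁺; any⁻)
open import Data.Product using (_×_; _,_; proj₁; proj₂; ∃-syntax; Σ-syntax; uncurry)
open import Data.Sum using (_⊎_; inj₁; inj₂)
import Data.Sum as Sum
open import Data.Vec using (_∷_; []; tabulate; lookup)
open import Data.Vec.Properties using ([]=⇒lookup; lookup⇒[]=; lookup∘tabulate; tabulate∘lookup; tabulate-cong)
open import Function using (_$_; _∘_)
open import Function.Bundles using (_⇔_; mk⇔; Equivalence)
open import Function.Construct.Composition using (_⇔-∘_)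
open import Function.Construct.Symmetry using (⇔-sym)
open import Relation.Binary.Definitions using (tri<; tri≈; tri>)
open import Relation.Binary.PropositionalEquality
open import Relation.Nullary using (¬_; Dec; yes; no)
open import Relation.Nullary.Decidable using (⌊_⌋; toWitness; fromWitness)

open +-*-Solver
open Equivalence using (to; from)

^-mono-∣ : ∀ b {m n} → m ≤ n → b ^ m ∣ b ^ n
^-mono-∣ b {m} {n} m≤n = divides (b ^ (n ∸ m)) (begin
  b ^ n               ≡⟨ cong (b ^_) (sym (m+[n∸m]≡n m≤n)) ⟩
  b ^ (m + (n ∸ m))   ≡⟨ ^-distribˡ-+-* b m (n ∸ m) ⟩
  b ^ m * b ^ (n ∸ m) ≡⟨ *-comm (b ^ m) _ ⟩
  b ^ (n ∸ m) * b ^ m ∎)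
  where open ≡-Reasoning

n<3^n : ∀ n → n < 3 ^ n
n<3^n zero    = s≤s z≤n
n<3^n (suc n) = ≤-<-trans (n<3^n n) (m<m+n (3 ^ n) (≤-trans (m^n>0 3 n) (m≤m+n (3 ^ n) _)))

∣⇒+≤ : ∀ {c x y} → c ∣ x → c ∣ y → x < y → x + c ≤ y
∣⇒+≤ {c} (divides a refl) (divides b refl) ac<bc = begin
  a * c + c ≡⟨ +-comm (a * c) c ⟩
  suc a * c ≤⟨ *-monoˡ-≤ c (*-cancelʳ-< c a b ac<bc) ⟩
  b * c     ∎
  where open ≤-Reasoning

[a+b%m]%m≡[a+b]%m : ∀ a b m .{{_ : NonZero m}} → (a + b % m) % m ≡ (a + b) % m
[a+b%m]%m≡[a+b]%m a b m = begin
  (a + b % m) % m           ≡⟨ %-distribˡ-+ a (b % m) m ⟩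
  (a % m + b % m % m) % m   ≡⟨ cong (λ t → (a % m + t) % m) (m%n%n≡m%n b m) ⟩
  (a % m + b % m) % m       ≡⟨ %-distribˡ-+ a b m ⟨
  (a + b) % m               ∎
  where open ≡-Reasoning

[m∸i+j]%m≡c%m⇔[i+c]%m≡j : ∀ {m i j c} .{{_ : NonZero m}} → i ≤ m → j < m →
                           (m ∸ i + j) % m ≡ c % m ⇔ (i + c) % m ≡ j
[m∸i+j]%m≡c%m⇔[i+c]%m≡j {m} {i} {j} {c} i≤m j<m = mk⇔ forth back
  where
  open ≡-Reasoning
  forth : (m ∸ i + j) % m ≡ c % m → (i + c) % m ≡ j
  forth eq = begin
    (i + c) % m               ≡⟨ [a+b%m]%m≡[a+b]%m i c m ⟨
    (i + c % m) % m           ≡⟨ cong (λ t → (i + t) % m) eq ⟨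
    (i + (m ∸ i + j) % m) % m ≡⟨ [a+b%m]%m≡[a+b]%m i (m ∸ i + j) m ⟩
    (i + (m ∸ i + j)) % m     ≡⟨ cong (_% m) (+-assoc i (m ∸ i) j) ⟨
    (i + (m ∸ i) + j) % m     ≡⟨ cong (λ t → (t + j) % m) (m+[n∸m]≡n i≤m) ⟩
    (m + j) % m               ≡⟨ %-remove-+ˡ j ∣-refl ⟩
    j % m                     ≡⟨ m<n⇒m%n≡m j<m ⟩
    j                         ∎
  back : (i + c) % m ≡ j → (m ∸ i + j) % m ≡ c % m
  back eq = begin
    (m ∸ i + j) % m           ≡⟨ cong (λ t → (m ∸ i + t) % m) eq ⟨
    (m ∸ i + (i + c) % m) % m ≡⟨ [a+b%m]%m≡[a+b]%m (m ∸ i) (i + c) m ⟩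
    (m ∸ i + (i + c)) % m     ≡⟨ cong (_% m) (+-assoc (m ∸ i) i c) ⟨
    (m ∸ i + i + c) % m       ≡⟨ cong (λ t → (t + c) % m) (m∸n+n≡m i≤m) ⟩
    (m + c) % m               ≡⟨ %-remove-+ˡ c ∣-refl ⟩
    c % m                     ∎

T-⌊⌋-∨ : ∀ {A B : Set} (a? : Dec A) (b? : Dec B) → T (⌊ a? ⌋ ∨ ⌊ b? ⌋) ⇔ (A ⊎ B)
T-⌊⌋-∨ a? b? = mk⇔ (Sum.map (toWitness {a? = a?}) (toWitness {a? = b?}) ∘ to T-∨)
                   (from (T-∨ {⌊ a? ⌋}) ∘ Sum.map (fromWitness {a? = a?}) (fromWitness {a? = b?}))

¬T⇒≡false : ∀ {b} → ¬ T b → b ≡ false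
¬T⇒≡false {false} _  = refl
¬T⇒≡false {true}  ¬T = ⊥-elim (¬T _)

∈⇔T-lookup : ∀ {N} {p : Subset N} {x} → x ∈ p ⇔ T (lookup p x)
∈⇔T-lookup {p = p} {x} = mk⇔ (from T-≡ ∘ []=⇒lookup) (lookup⇒[]= x p ∘ to T-≡)

∈-tabulate : ∀ {N} {f : Fin N → Bool} {x} → x ∈ tabulate f ⇔ T (f x)
∈-tabulate {f = f} {x} = subst (λ b → x ∈ tabulate f ⇔ T b) (lookup∘tabulate f x) ∈⇔T-lookup

∣p∣+∣q∣≡∣p∩q∣+∣p∪q∣ : ∀ {N} (p q : Subset N) → ∣ p ∣ + ∣ q ∣ ≡ ∣ p ∩ q ∣ + ∣ p ∪ q ∣
∣p∣+∣q∣≡∣p∩q∣+∣p∪q∣ []          []          = refl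
∣p∣+∣q∣≡∣p∩q∣+∣p∪q∣ (true  ∷ p) (true  ∷ q) = cong suc (begin
  ∣ p ∣ + suc ∣ q ∣         ≡⟨ +-suc ∣ p ∣ ∣ q ∣ ⟩
  suc (∣ p ∣ + ∣ q ∣)       ≡⟨ cong suc (∣p∣+∣q∣≡∣p∩q∣+∣p∪q∣ p q) ⟩
  suc (∣ p ∩ q ∣ + ∣ p ∪ q ∣) ≡⟨ +-suc ∣ p ∩ q ∣ ∣ p ∪ q ∣ ⟨
  ∣ p ∩ q ∣ + suc ∣ p ∪ q ∣ ∎)
  where open ≡-Reasoning
∣p∣+∣q∣≡∣p∩q∣+∣p∪q∣ (true  ∷ p) (false ∷ q) =
  trans (cong suc (∣p∣+∣q∣≡∣p∩q∣+∣p∪q∣ p q)) (sym (+-suc ∣ p ∩ q ∣ ∣ p ∪ q ∣))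
∣p∣+∣q∣≡∣p∩q∣+∣p∪q∣ (false ∷ p) (true  ∷ q) =
  trans (+-suc ∣ p ∣ ∣ q ∣) (trans (cong suc (∣p∣+∣q∣≡∣p∩q∣+∣p∪q∣ p q)) (sym (+-suc ∣ p ∩ q ∣ ∣ p ∪ q ∣)))
∣p∣+∣q∣≡∣p∩q∣+∣p∪q∣ (false ∷ p) (false ∷ q) = ∣p∣+∣q∣≡∣p∩q∣+∣p∪q∣ p q

∣p∣≡∣p↑ˡ∣+∣p↑ʳ∣ : ∀ m {k} (p : Subset (m + k)) →
                  ∣ p ∣ ≡ ∣ tabulate (lookup p ∘ (_↑ˡ k)) ∣ + ∣ tabulate (lookup p ∘ (m ↑ʳ_)) ∣
∣p∣≡∣p↑ˡ∣+∣p↑ʳ∣ zero    p           = cong ∣_∣ (sym (tabulate∘lookup p))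
∣p∣≡∣p↑ˡ∣+∣p↑ʳ∣ (suc m) (true  ∷ p) = cong suc (∣p∣≡∣p↑ˡ∣+∣p↑ʳ∣ m p)
∣p∣≡∣p↑ˡ∣+∣p↑ʳ∣ (suc m) (false ∷ p) = ∣p∣≡∣p↑ˡ∣+∣p↑ʳ∣ m p

x∈p⇒0<∣p∣ : ∀ {N} {p : Subset N} {x} → x ∈ p → 0 < ∣ p ∣
x∈p⇒0<∣p∣ {p = p} {x} x∈p = subst (_≤ ∣ p ∣) (∣⁅x⁆∣≡1 x)
  (p⊆q⇒∣p∣≤∣q∣ (λ y∈⁅x⁆ → subst (_∈ p) (sym (x∈⁅y⁆⇒x≡y x y∈⁅x⁆)) x∈p))

∈-unique⇒≡⁅x⁆ : ∀ {N} {p : Subset N} {x} → x ∈ p → (∀ {y} → y ∈ p → y ≡ x) → p ≡ ⁅ x ⁆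
∈-unique⇒≡⁅x⁆ {p = p} x∈p unique = ⊆-antisym
  (λ y∈p → from x∈⁅y⁆⇔x≡y (unique y∈p))
  (λ y∈⁅x⁆ → subst (_∈ p) (sym (to x∈⁅y⁆⇔x≡y y∈⁅x⁆)) x∈p)

∀∈⇒≡⊤ : ∀ {N} {p : Subset N} → (∀ x → x ∈ p) → p ≡ ⊤
∀∈⇒≡⊤ ∀∈p = ⊆-antisym (λ _ → ∈⊤) (λ {x} _ → ∀∈p x)

0<∣p∣⇒Nonempty : ∀ {N} {p : Subset N} → 0 < ∣ p ∣ → Nonempty p
0<∣p∣⇒Nonempty {N} {p} 0<∣p∣ with nonempty? p
... | yes ne  = ne
... | no ¬ne = ⊥-elim (n≮n 0 (subst (0 <_) (trans (cong ∣_∣ (Empty-unique ¬ne)) (∣⊥∣≡0 N)) 0<∣p∣))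

∃<⇒∃Fin : ∀ {N} {P : ℕ → Set} → (∃[ j ] j < N × P j) → Σ[ j ∈ Fin N ] P (toℕ j)
∃<⇒∃Fin {P = P} (j , j<N , p) = fromℕ< j<N , subst P (sym (toℕ-fromℕ< j<N)) p

IsDigit : ℕ → Set
IsDigit r = r ≡ 1 ⊎ r ≡ 2

digit>0 : ∀ {r} → IsDigit r → 0 < r
digit>0 (inj₁ refl) = s≤s z≤n
digit>0 (inj₂ refl) = s≤s z≤n

digit<3 : ∀ {r} → IsDigit r → r < 3
digit<3 (inj₁ refl) = s≤s (s≤s z≤n)
digit<3 (inj₂ refl) = s≤s (s≤s (s≤s z≤n))

-- For IsDigit r: the right-most nonzero base-3 digit of x is r, in position v.
data TrailingDigit (v r : ℕ) : ℕ → Set where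
  trailing : ∀ q → TrailingDigit v r (3 ^ v * (3 * q + r))

[3q+r]%3≡r : ∀ q {r} → r < 3 → (3 * q + r) % 3 ≡ r
[3q+r]%3≡r q {r} r<3 = begin
  (3 * q + r) % 3 ≡⟨ %-remove-+ˡ r (divides q (*-comm 3 q)) ⟩
  r % 3           ≡⟨ m<n⇒m%n≡m r<3 ⟩
  r               ∎
  where open ≡-Reasoning

[3q]/3≡q : ∀ q → (3 * q) / 3 ≡ q
[3q]/3≡q q = trans (cong (_/ 3) (*-comm 3 q)) (m*n/n≡m q 3)

digit3-go-divisible : ∀ f m → m % 3 ≡ 0 → digit3-go (suc f) m ≡ digit3-go f (m / 3)
digit3-go-divisible f m m%3≡0 with m % 3
digit3-go-divisible f m refl | .0 = refl

digit3-go-indivisible : ∀ f m {r} → m % 3 ≡ suc r → digit3-go (suc f) m ≡ suc r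
digit3-go-indivisible f m m%3≡r with m % 3
digit3-go-indivisible f m refl | .(suc _) = refl

digit3-go-unit : ∀ f q {r} → IsDigit r → digit3-go f (3 * q + r) ≡ r
digit3-go-unit zero    q dr              = [3q+r]%3≡r q (digit<3 dr)
digit3-go-unit (suc f) q dr@(inj₁ refl) = digit3-go-indivisible f (3 * q + 1) ([3q+r]%3≡r q (digit<3 dr))
digit3-go-unit (suc f) q dr@(inj₂ refl) = digit3-go-indivisible f (3 * q + 2) ([3q+r]%3≡r q (digit<3 dr))

digit3-go-form : ∀ f v q {r} → v ≤ f → IsDigit r → digit3-go f (3 ^ v * (3 * q + r)) ≡ r
digit3-go-form f zero q {r} z≤n dr =
  trans (cong (digit3-go f) (*-identityˡ (3 * q + r))) (digit3-go-unit f q dr)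
digit3-go-form (suc f) (suc v) q {r} (s≤s v≤f) dr = begin
  digit3-go (suc f) (3 * 3 ^ v * x)   ≡⟨ cong (digit3-go (suc f)) (*-assoc 3 (3 ^ v) x) ⟩
  digit3-go (suc f) (3 * (3 ^ v * x)) ≡⟨ digit3-go-divisible f (3 * (3 ^ v * x)) 3∣ ⟩
  digit3-go f (3 * (3 ^ v * x) / 3)   ≡⟨ cong (digit3-go f) ([3q]/3≡q (3 ^ v * x)) ⟩
  digit3-go f (3 ^ v * x)             ≡⟨ digit3-go-form f v q v≤f dr ⟩
  r                                   ∎
  where
  open ≡-Reasoning
  x : ℕ
  x = 3 * q + r
  3∣ : 3 * (3 ^ v * x) % 3 ≡ 0
  3∣ = trans (cong (_% 3) (*-comm 3 (3 ^ v * x))) (m*n%n≡0 (3 ^ v * x) 3)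

trailing⇒3^v≤ : ∀ {v r x} → IsDigit r → TrailingDigit v r x → 3 ^ v ≤ x
trailing⇒3^v≤ {v} {r} dr (trailing q) = begin
  3 ^ v               ≡⟨ *-identityʳ (3 ^ v) ⟨
  3 ^ v * 1           ≤⟨ *-monoʳ-≤ (3 ^ v) (≤-trans (digit>0 dr) (m≤n+m r (3 * q))) ⟩
  3 ^ v * (3 * q + r) ∎
  where open ≤-Reasoning

trailing⇒pos : ∀ {v r x} → IsDigit r → TrailingDigit v r x → 0 < x
trailing⇒pos {v} dr t = <-≤-trans (m^n>0 3 v) (trailing⇒3^v≤ dr t)

-- [ x ]₃ runs digit3-go with fuel x, and v < 3ᵛ ≤ x.
trailing⇒[]₃≡ : ∀ {v r x} → IsDigit r → TrailingDigit v r x → [ x ]₃ ≡ r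
trailing⇒[]₃≡ {v} {x = x} dr t@(trailing q) =
  digit3-go-form x v q (<⇒≤ (<-≤-trans (n<3^n v) (trailing⇒3^v≤ dr t))) dr

trailing′ : ∀ {v r x} q → x ≡ 3 ^ v * (3 * q + r) → TrailingDigit v r x
trailing′ q refl = trailing q

trailing⁻¹ : ∀ {v r x} → TrailingDigit v r x → ∃[ q ] x ≡ 3 ^ v * (3 * q + r)
trailing⁻¹ (trailing q) = q , refl

trailing-3* : ∀ {v r y} → TrailingDigit v r y → TrailingDigit (suc v) r (3 * y)
trailing-3* {v} {r} (trailing q) = trailing′ q (sym (*-assoc 3 (3 ^ v) (3 * q + r)))

trailingDigit-exists : ∀ x → 0 < x → ∃[ v ] ∃[ r ] IsDigit r × TrailingDigit v r x
trailingDigit-exists = <-rec _ go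
  where
  go : ∀ x → (∀ {y} → y < x → 0 < y → ∃[ v ] ∃[ r ] IsDigit r × TrailingDigit v r y) →
       0 < x → ∃[ v ] ∃[ r ] IsDigit r × TrailingDigit v r x
  go x rec 0<x with x % 3 | m%n<n x 3 | m≡m%n+[m/n]*n x 3
  ... | suc (suc (suc _)) | s≤s (s≤s (s≤s ())) | _
  ... | 1 | _ | x≡ = 0 , 1 , inj₁ refl , trailing′ (x / 3) (trans x≡
    (solve 1 (λ y → con 1 :+ y :* con 3 := con 1 :* (con 3 :* y :+ con 1)) refl (x / 3)))
  ... | 2 | _ | x≡ = 0 , 2 , inj₂ refl , trailing′ (x / 3) (trans x≡
    (solve 1 (λ y → con 2 :+ y :* con 3 := con 1 :* (con 3 :* y :+ con 2)) refl (x / 3)))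
  ... | 0 | _ | x≡ with rec (m/n<m x 3 {{>-nonZero 0<x}} (s≤s (s≤s z≤n))) 0<x/3
    where
    0<x/3 : 0 < x / 3
    0<x/3 = n≢0⇒n>0 (λ x/3≡0 → n>0⇒n≢0 0<x (trans x≡ (cong (_* 3) x/3≡0)))
  ...   | v , r , dr , t = suc v , r , dr ,
    subst (TrailingDigit (suc v) r) (sym (trans x≡ (*-comm (x / 3) 3))) (trailing-3* t)

trailing⇒3^v∣ : ∀ {v r x} → TrailingDigit v r x → 3 ^ v ∣ x
trailing⇒3^v∣ {v} {r} (trailing q) = divides (3 * q + r) (*-comm (3 ^ v) _)

trailing⇒¬3^w∣ : ∀ {v w r x} → v < w → IsDigit r → TrailingDigit v r x → ¬ (3 ^ w ∣ x)
trailing⇒¬3^w∣ {v} {w} {r} v<w dr (trailing q) 3^w∣x with ∣-trans (^-mono-∣ 3 v<w) 3^w∣x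
... | divides m x≡m*3^[1+v] = <-irrefl r≡0 (digit>0 dr)
  where
  3q+r≡3m : 3 * q + r ≡ 3 * m
  3q+r≡3m = *-cancelˡ-≡ _ _ (3 ^ v) {{m^n≢0 3 v}} (begin
    3 ^ v * (3 * q + r) ≡⟨ x≡m*3^[1+v] ⟩
    m * (3 * 3 ^ v)     ≡⟨ solve 2 (λ m P → m :* (con 3 :* P) := P :* (con 3 :* m)) refl m (3 ^ v) ⟩
    3 ^ v * (3 * m)     ∎)
    where open ≡-Reasoning
  r≡0 : 0 ≡ r
  r≡0 = begin
    0               ≡⟨ m*n%n≡0 m 3 ⟨
    m * 3 % 3       ≡⟨ cong (_% 3) (trans (*-comm m 3) (sym 3q+r≡3m)) ⟩
    (3 * q + r) % 3 ≡⟨ [3q+r]%3≡r q (digit<3 dr) ⟩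
    r               ∎
    where open ≡-Reasoning

trailingDigit-unique : ∀ {v w r s x} → IsDigit r → IsDigit s →
                       TrailingDigit v r x → TrailingDigit w s x → v ≡ w × r ≡ s
trailingDigit-unique {v} {w} dr ds tv tw with <-cmp v w
... | tri< v<w _ _ = ⊥-elim (trailing⇒¬3^w∣ v<w dr tv (trailing⇒3^v∣ tw))
... | tri> _ _ w<v = ⊥-elim (trailing⇒¬3^w∣ w<v ds tw (trailing⇒3^v∣ tv))
... | tri≈ _ refl _ = refl , digits-equal dr ds tv tw
  where
  digits-equal : ∀ {v r s x} → IsDigit r → IsDigit s → TrailingDigit v r x → TrailingDigit v s x → r ≡ s
  digits-equal {v} {r} {s} dr ds (trailing q) t with trailing⁻¹ t
  ... | q' , x≡ = begin
    r                ≡⟨ [3q+r]%3≡r q (digit<3 dr) ⟨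
    (3 * q + r) % 3  ≡⟨ cong (_% 3) (*-cancelˡ-≡ _ _ (3 ^ v) {{m^n≢0 3 v}} x≡) ⟩
    (3 * q' + s) % 3 ≡⟨ [3q+r]%3≡r q' (digit<3 ds) ⟩
    s                ∎
    where open ≡-Reasoning

[]₃≡⇒trailing : ∀ {x r} → IsDigit r → [ x ]₃ ≡ r → ∃[ v ] TrailingDigit v r x
[]₃≡⇒trailing {zero}  dr 0≡r = ⊥-elim (<-irrefl 0≡r (digit>0 dr))
[]₃≡⇒trailing {suc x} dr [x]₃≡r with trailingDigit-exists (suc x) (s≤s z≤n)
... | v , r' , dr' , t with trans (sym (trailing⇒[]₃≡ dr' t)) [x]₃≡r
... | refl = v , t

[]₃-isDigit : ∀ {x} → 0 < x → IsDigit [ x ]₃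
[]₃-isDigit {x} 0<x with trailingDigit-exists x 0<x
... | v , r , dr , t rewrite trailing⇒[]₃≡ dr t = dr

trailing-3^v : ∀ v → TrailingDigit v 1 (3 ^ v)
trailing-3^v v = trailing′ 0 (sym (*-identityʳ (3 ^ v)))

trailing-+-∣ : ∀ {v r x c} → 3 ^ suc v ∣ c → TrailingDigit v r x → TrailingDigit v r (x + c)
trailing-+-∣ {v} {r} (divides m refl) (trailing q) = trailing′ (q + m) $
  solve 4 (λ P q r m → P :* (con 3 :* q :+ r) :+ m :* (con 3 :* P) := P :* (con 3 :* (q :+ m) :+ r))
        refl (3 ^ v) q r m

trailing-1→2 : ∀ {v i} → TrailingDigit v 1 i → TrailingDigit v 2 (i + 3 ^ v)
trailing-1→2 {v} (trailing q) = trailing′ q $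
  solve 2 (λ P q → P :* (con 3 :* q :+ con 1) :+ P := P :* (con 3 :* q :+ con 2)) refl (3 ^ v) q

trailing-2→1 : ∀ {v j} → TrailingDigit v 2 j → ∃[ i ] TrailingDigit v 1 i × j ≡ i + 3 ^ v
trailing-2→1 {v} (trailing q) = 3 ^ v * (3 * q + 1) , trailing q ,
  solve 2 (λ P q → P :* (con 3 :* q :+ con 2) := P :* (con 3 :* q :+ con 1) :+ P) refl (3 ^ v) q

3^v[3q+r]≡3^v*r+q*3^[1+v] : ∀ v q r → 3 ^ v * (3 * q + r) ≡ 3 ^ v * r + q * 3 ^ suc v
3^v[3q+r]≡3^v*r+q*3^[1+v] v q r =
  solve 3 (λ q r P → P :* (con 3 :* q :+ r) := P :* r :+ q :* (con 3 :* P)) refl q r (3 ^ v)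

-- x % m ≡ x modulo 3ᵛ⁺¹, and the residue 3ᵛ r modulo 3ᵛ⁺¹ determines the trailing digit.
trailing-%-∣ : ∀ {v r x} m .{{_ : NonZero m}} → 3 ^ suc v ∣ m → IsDigit r →
               TrailingDigit v r x → TrailingDigit v r (x % m)
trailing-%-∣ {v} {r} m P∣m dr (trailing q) = trailing′ (y / P) (begin
  y                         ≡⟨ m≡m%n+[m/n]*n y P ⟩
  y % P + y / P * P         ≡⟨ cong (_+ y / P * P) y%P≡3^v*r ⟩
  3 ^ v * r + y / P * P     ≡⟨ 3^v[3q+r]≡3^v*r+q*3^[1+v] v (y / P) r ⟨
  3 ^ v * (3 * (y / P) + r) ∎)
  where
  open ≡-Reasoning
  P : ℕ
  P = 3 ^ suc v
  instance
    P-nonZero : NonZero P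
    P-nonZero = m^n≢0 3 (suc v)
  y : ℕ
  y = 3 ^ v * (3 * q + r) % m
  3^v*r<P : 3 ^ v * r < P
  3^v*r<P = subst (3 ^ v * r <_) (*-comm (3 ^ v) 3) (*-monoʳ-< (3 ^ v) {{m^n≢0 3 v}} (digit<3 dr))
  y%P≡3^v*r : y % P ≡ 3 ^ v * r
  y%P≡3^v*r = begin
    y % P                   ≡⟨ m∣n⇒o%n%m≡o%m P m _ P∣m ⟩
    3 ^ v * (3 * q + r) % P ≡⟨ cong (_% P) (3^v[3q+r]≡3^v*r+q*3^[1+v] v q r) ⟩
    (3 ^ v * r + q * P) % P ≡⟨ [m+kn]%n≡m%n (3 ^ v * r) q P ⟩
    3 ^ v * r % P           ≡⟨ m<n⇒m%n≡m 3^v*r<P ⟩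
    3 ^ v * r               ∎

module Matching (d : ℕ) where
  open Thm d using (n; n-nonZero)

  RotInM RefInM : ℕ → Set
  RotInM i = i ≡ 0 ⊎ [ i ]₃ ≡ 1
  RefInM j = j ≡ 0 ⊎ [ j ]₃ ≡ 2

  -- aⁱ ~ aʲb in G: (aⁱ)⁻¹ aʲ b = aʲ⁻ⁱ b must be one of the a^(3ᵏ) b in C.
  Linked : ℕ → ℕ → Set
  Linked i j = ∃[ k ] k ≤ d × (i + 3 ^ k) % n ≡ j

  Matched : ℕ → ℕ → Set
  Matched i j = (i ≡ 0 × j ≡ 0) ⊎ ∃[ v ] TrailingDigit v 1 i × j ≡ i + 3 ^ v

  3^v∣n : ∀ {v} → v ≤ d → 3 ^ v ∣ n
  3^v∣n = ^-mono-∣ 3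

  trailing<n⇒v<d : ∀ {v r x} → IsDigit r → TrailingDigit v r x → x < n → v < d
  trailing<n⇒v<d dr t x<n =
    ≰⇒> (λ d≤v → n≮n _ (<-≤-trans x<n (≤-trans (^-monoʳ-≤ 3 d≤v) (trailing⇒3^v≤ dr t))))

  partner<n : ∀ {v i} → TrailingDigit v 1 i → i < n → i + 3 ^ v < n
  partner<n {v} {i} t i<n = ≤∧≢⇒< i+3^v≤n i+3^v≢n
    where
    i+3^v≤n : i + 3 ^ v ≤ n
    i+3^v≤n = ∣⇒+≤ (trailing⇒3^v∣ t) (3^v∣n (<⇒≤ (trailing<n⇒v<d (inj₁ refl) t i<n))) i<n
    -- n = 3ᵈ has trailing digit 1, while i + 3ᵛ has trailing digit 2.
    i+3^v≢n : i + 3 ^ v ≢ n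
    i+3^v≢n i+3^v≡n with trailingDigit-unique (inj₂ refl) (inj₁ refl)
                           (trailing-1→2 t) (subst (TrailingDigit d 1) (sym i+3^v≡n) (trailing-3^v d))
    ... | _ , ()

  [i+3^k]%n-cases : ∀ {v i k} → TrailingDigit v 1 i → i < n → k ≤ d →
                    (i + 3 ^ k) % n ≡ i + 3 ^ v ⊎ ∃[ w ] TrailingDigit w 1 ((i + 3 ^ k) % n)
  [i+3^k]%n-cases {v} {i} {k} t i<n k≤d with <-cmp k v
  ... | tri≈ _ refl _ = inj₁ (m<n⇒m%n≡m (partner<n t i<n))
  ... | tri> _ _ v<k  = inj₂ (v , trailing-%-∣ n (3^v∣n (<-≤-trans v<k k≤d)) (inj₁ refl)
                                    (trailing-+-∣ (^-mono-∣ 3 v<k) t))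
  ... | tri< k<v _ _  = inj₂ (k , subst (TrailingDigit k 1) (sym (m<n⇒m%n≡m i+3^k<n)) trailing-i+3^k)
    where
    i+3^k<n : i + 3 ^ k < n
    i+3^k<n = <-trans (+-monoʳ-< i (^-monoʳ-< 3 (s≤s (s≤s z≤n)) k<v)) (partner<n t i<n)
    trailing-i+3^k : TrailingDigit k 1 (i + 3 ^ k)
    trailing-i+3^k = subst (TrailingDigit k 1) (+-comm (3 ^ k) i)
                       (trailing-+-∣ (∣-trans (^-mono-∣ 3 k<v) (trailing⇒3^v∣ t)) (trailing-3^v k))

  [3^k]%n-cases : ∀ {k} → k ≤ d → 3 ^ k % n ≡ 0 ⊎ ∃[ w ] TrailingDigit w 1 (3 ^ k % n)
  [3^k]%n-cases {k} k≤d with m≤n⇒m<n∨m≡n k≤d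
  ... | inj₂ refl = inj₁ (n%n≡0 n)
  ... | inj₁ k<d  = inj₂ (k , subst (TrailingDigit k 1) (sym (m<n⇒m%n≡m (^-monoʳ-< 3 (s≤s (s≤s z≤n)) k<d)))
                                (trailing-3^v k))

  trailing1⇒RotInM : ∀ {v i} → TrailingDigit v 1 i → RotInM i
  trailing1⇒RotInM t = inj₂ (trailing⇒[]₃≡ (inj₁ refl) t)

  trailing2⇒RefInM : ∀ {v j} → TrailingDigit v 2 j → RefInM j
  trailing2⇒RefInM t = inj₂ (trailing⇒[]₃≡ (inj₂ refl) t)

  trailing1⇒¬RefInM : ∀ {w j} → TrailingDigit w 1 j → ¬ RefInM j
  trailing1⇒¬RefInM t (inj₁ refl)     = n≮n 0 (trailing⇒pos (inj₁ refl) t)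
  trailing1⇒¬RefInM t (inj₂ [j]₃≡2) with trans (sym (trailing⇒[]₃≡ (inj₁ refl) t)) [j]₃≡2
  ... | ()

  RotInM⊎RefInM : ∀ i → RotInM i ⊎ RefInM i
  RotInM⊎RefInM zero    = inj₁ (inj₁ refl)
  RotInM⊎RefInM (suc i) = Sum.map inj₂ inj₂ ([]₃-isDigit {suc i} (s≤s z≤n))

  RotInM×RefInM⇒≡0 : ∀ {i} → RotInM i → RefInM i → i ≡ 0
  RotInM×RefInM⇒≡0 (inj₁ i≡0) _          = i≡0
  RotInM×RefInM⇒≡0 (inj₂ _)   (inj₁ i≡0) = i≡0
  RotInM×RefInM⇒≡0 (inj₂ [i]₃≡1) (inj₂ [i]₃≡2) with trans (sym [i]₃≡1) [i]₃≡2
  ... | ()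

  linked⇒matched : ∀ {i j} → i < n → RotInM i → RefInM j → Linked i j → Matched i j
  linked⇒matched i<n (inj₁ refl) jM (k , k≤d , refl) with [3^k]%n-cases k≤d
  ... | inj₁ 3^k%n≡0 = inj₁ (refl , 3^k%n≡0)
  ... | inj₂ (_ , t) = ⊥-elim (trailing1⇒¬RefInM t jM)
  linked⇒matched i<n (inj₂ [i]₃≡1) jM (k , k≤d , refl) with []₃≡⇒trailing (inj₁ refl) [i]₃≡1
  ... | v , t with [i+3^k]%n-cases t i<n k≤d
  ...   | inj₁ j≡i+3^v = inj₂ (v , t , j≡i+3^v)
  ...   | inj₂ (_ , t') = ⊥-elim (trailing1⇒¬RefInM t' jM)

  matched⇒linked : ∀ {i j} → i < n → Matched i j → Linked i j
  matched⇒linked _   (inj₁ (refl , refl))   = d , ≤-refl , n%n≡0 n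
  matched⇒linked i<n (inj₂ (v , t , refl)) =
    v , <⇒≤ (trailing<n⇒v<d (inj₁ refl) t i<n) , m<n⇒m%n≡m (partner<n t i<n)

  linked-refl : ∀ {i} → i < n → Linked i i
  linked-refl {i} i<n = d , ≤-refl , trans ([m+n]%n≡m%n i n) (m<n⇒m%n≡m i<n)

  matched-functional : ∀ {i j j'} → Matched i j → Matched i j' → j ≡ j'
  matched-functional (inj₁ (_ , refl))     (inj₁ (_ , refl))       = refl
  matched-functional (inj₁ (refl , _))     (inj₂ (_ , t , _))      =
    ⊥-elim (n≮n 0 (trailing⇒pos (inj₁ refl) t))
  matched-functional (inj₂ (_ , t , _))    (inj₁ (refl , _))       =
    ⊥-elim (n≮n 0 (trailing⇒pos (inj₁ refl) t))
  matched-functional (inj₂ (v , t , refl)) (inj₂ (v' , t' , refl))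
    with trailingDigit-unique (inj₁ refl) (inj₁ refl) t t'
  ... | refl , _ = refl

  matched-injective : ∀ {i i' j} → Matched i j → Matched i' j → i ≡ i'
  matched-injective (inj₁ (refl , _))     (inj₁ (refl , _))      = refl
  matched-injective (inj₁ (_ , refl))     (inj₂ (_ , t , 0≡))    =
    ⊥-elim (n≮n 0 (trailing⇒pos (inj₂ refl) (subst (TrailingDigit _ 2) (sym 0≡) (trailing-1→2 t))))
  matched-injective (inj₂ (_ , t , 0≡))   (inj₁ (_ , refl))      =
    ⊥-elim (n≮n 0 (trailing⇒pos (inj₂ refl) (subst (TrailingDigit _ 2) (sym 0≡) (trailing-1→2 t))))
  matched-injective {i} {i'} (inj₂ (v , t , refl)) (inj₂ (v' , t' , i+3^v≡i'+3^v'))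
    with trailingDigit-unique (inj₂ refl) (inj₂ refl)
           (trailing-1→2 t) (subst (TrailingDigit v' 2) (sym i+3^v≡i'+3^v') (trailing-1→2 t'))
  ... | refl , _ = +-cancelʳ-≡ (3 ^ v) i i' i+3^v≡i'+3^v'

  rot-partner : ∀ {i} → i < n → RotInM i → Σ[ j ∈ Fin n ] RefInM (toℕ j) × Matched i (toℕ j)
  rot-partner i<n iM = ∃<⇒∃Fin (partner i<n iM)
    where
    partner : ∀ {i} → i < n → RotInM i → ∃[ j ] j < n × RefInM j × Matched i j
    partner _ (inj₁ refl) = 0 , m^n>0 3 d , inj₁ refl , inj₁ (refl , refl)
    partner {i} i<n (inj₂ [i]₃≡1) with []₃≡⇒trailing {i} (inj₁ refl) [i]₃≡1
    ... | v , t = i + 3 ^ v , partner<n t i<n , trailing2⇒RefInM (trailing-1→2 t) , inj₂ (v , t , refl)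

  ref-partner : ∀ {j} → j < n → RefInM j → Σ[ i ∈ Fin n ] RotInM (toℕ i) × Matched (toℕ i) j
  ref-partner j<n jM = ∃<⇒∃Fin (partner j<n jM)
    where
    partner : ∀ {j} → j < n → RefInM j → ∃[ i ] i < n × RotInM i × Matched i j
    partner _ (inj₁ refl) = 0 , m^n>0 3 d , inj₁ refl , inj₁ (refl , refl)
    partner {j} j<n (inj₂ [j]₃≡2) with []₃≡⇒trailing {j} (inj₂ refl) [j]₃≡2
    ... | v , t with trailing-2→1 t
    ...   | i , t' , refl = i , ≤-<-trans (m≤m+n i _) j<n , trailing1⇒RotInM t' , inj₂ (v , t' , refl)

module Adjacency (d : ℕ) where
  open Thm d
  open Matching d

  inC-rot : ∀ x → proj₁ x ≡ 0F → ¬ T (inC x)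
  inC-rot (_ , m) refl h = proj₂ (satisfied (any⁻ (λ k → (0F , m) ≟D rotb (3 ^ k)) (upTo (suc d)) h))

  inC-ref : ∀ m → T (inC (1F , m)) ⇔ (∃[ k ] k ≤ d × toℕ m ≡ 3 ^ k % n)
  inC-ref m = mk⇔ forth back
    where
    forth : T (inC (1F , m)) → ∃[ k ] k ≤ d × toℕ m ≡ 3 ^ k % n
    forth h with find (any⁻ (λ k → (1F , m) ≟D rotb (3 ^ k)) (upTo (suc d)) h)
    ... | k , k∈ , m≟ = k , s≤s⁻¹ (∈-upTo⁻ k∈) , trans (cong toℕ (toWitness m≟)) (toℕ-fromℕ< _)
    back : ∃[ k ] k ≤ d × toℕ m ≡ 3 ^ k % n → T (inC (1F , m))
    back (k , k≤d , m≡) = any⁺ _ (lose (∈-upTo⁺ (s≤s k≤d))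
                            (fromWitness (toℕ-injective (trans m≡ (sym (toℕ-fromℕ< _))))))

  -- Chosen so that ((1F , j) ⁻¹) · (0F , i) ≡ (1F , offset i j) holds by definition.
  offset : Fin n → Fin n → Fin n
  offset i j = (toℕ j + (n ∸ toℕ i)) mod n

  toℕ-offset : ∀ i j → toℕ (offset i j) ≡ (n ∸ toℕ i + toℕ j) % n
  toℕ-offset i j = trans (toℕ-fromℕ< _) (cong (_% n) (+-comm (toℕ j) (n ∸ toℕ i)))

  rot⁻¹·ref : ∀ i j → ((0F , i) ⁻¹) · (1F , j) ≡ (1F , offset i j)
  rot⁻¹·ref i j = cong (1F ,_) (toℕ-injective (begin
    toℕ ((toℕ ((n ∸ toℕ i) mod n) + toℕ j) mod n) ≡⟨ toℕ-fromℕ< _ ⟩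
    (toℕ ((n ∸ toℕ i) mod n) + toℕ j) % n         ≡⟨ cong (λ t → (t + toℕ j) % n) (toℕ-fromℕ< _) ⟩
    ((n ∸ toℕ i) % n + toℕ j) % n                 ≡⟨ cong (_% n) (+-comm ((n ∸ toℕ i) % n) (toℕ j)) ⟩
    (toℕ j + (n ∸ toℕ i) % n) % n                 ≡⟨ [a+b%m]%m≡[a+b]%m (toℕ j) (n ∸ toℕ i) n ⟩
    (toℕ j + (n ∸ toℕ i)) % n                     ≡⟨ toℕ-fromℕ< _ ⟨
    toℕ (offset i j)                              ∎))
    where open ≡-Reasoning

  inC-offset : ∀ i j → T (inC (1F , offset i j)) ⇔ Linked (toℕ i) (toℕ j)
  inC-offset i j = mk⇔
    (λ h → let k , k≤d , eq = to (inC-ref _) h in k , k≤d , to (offset≡ k) eq)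
    (λ (k , k≤d , eq) → from (inC-ref _) (k , k≤d , from (offset≡ k) eq))
    where
    offset≡ : ∀ k → toℕ (offset i j) ≡ 3 ^ k % n ⇔ (toℕ i + 3 ^ k) % n ≡ toℕ j
    offset≡ k rewrite toℕ-offset i j = [m∸i+j]%m≡c%m⇔[i+c]%m≡j (<⇒≤ (toℕ<n i)) (toℕ<n j)

  cayAdj-rot-ref : ∀ i j → cayAdj inC (0F , i) (1F , j) ≡ inC (1F , offset i j)
  cayAdj-rot-ref i j =
    trans (cong (λ y → inC y ∨ inC (1F , offset i j)) (rot⁻¹·ref i j)) (∨-idem _)

  cayAdj-ref-rot : ∀ i j → cayAdj inC (1F , j) (0F , i) ≡ inC (1F , offset i j)
  cayAdj-ref-rot i j =
    trans (cong (λ y → inC (1F , offset i j) ∨ inC y) (rot⁻¹·ref i j)) (∨-idem _)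

  adj-rot-ref : ∀ i j → T (cayAdj inC (0F , i) (1F , j)) ⇔ Linked (toℕ i) (toℕ j)
  adj-rot-ref i j rewrite cayAdj-rot-ref i j = inC-offset i j

  adj-ref-rot : ∀ i j → T (cayAdj inC (1F , j) (0F , i)) ⇔ Linked (toℕ i) (toℕ j)
  adj-ref-rot i j rewrite cayAdj-ref-rot i j = inC-offset i j

  T-cayAdj⇒ : ∀ {C} x y → T (cayAdj C x y) → T (C ((x ⁻¹) · y)) ⊎ T (C ((y ⁻¹) · x))
  T-cayAdj⇒ x y = to T-∨ ∘ proj₂ ∘ to (T-∧ {not (x ≟D y)})

  nonadj-rot-rot : ∀ i j → ¬ T (cayAdj inC (0F , i) (0F , j))
  nonadj-rot-rot i j =
    Sum.[ inC-rot (((0F , i) ⁻¹) · (0F , j)) refl , inC-rot (((0F , j) ⁻¹) · (0F , i)) refl ]′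
    ∘ T-cayAdj⇒ {inC} (0F , i) (0F , j)

  nonadj-ref-ref : ∀ i j → ¬ T (cayAdj inC (1F , i) (1F , j))
  nonadj-ref-ref i j =
    Sum.[ inC-rot (((1F , i) ⁻¹) · (1F , j)) refl , inC-rot (((1F , j) ⁻¹) · (1F , i)) refl ]′
    ∘ T-cayAdj⇒ {inC} (1F , i) (1F , j)

  inM-rot : ∀ i → T (inM (0F , i)) ⇔ RotInM (toℕ i)
  inM-rot i = T-⌊⌋-∨ (toℕ i ℕ.≟ 0) ([ toℕ i ]₃ ℕ.≟ 1)

  inM-ref : ∀ j → T (inM (1F , j)) ⇔ RefInM (toℕ j)
  inM-ref j = T-⌊⌋-∨ (toℕ j ℕ.≟ 0) ([ toℕ j ]₃ ℕ.≟ 2)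

  UniqueNeighbourInM : D → Set
  UniqueNeighbourInM x = Σ[ y ∈ D ] (T (inM y) × T (cayAdj inC x y)) ×
                                   (∀ z → T (inM z) → T (cayAdj inC x z) → z ≡ y)

  uniqueNeighbourInM : ∀ x → T (inM x) → UniqueNeighbourInM x
  uniqueNeighbourInM (0F , i) i∈M with rot-partner (toℕ<n i) (to (inM-rot i) i∈M)
  ... | j , jM , ij = (1F , j) , (from (inM-ref j) jM , i~j) , unique
    where
    i~j : T (cayAdj inC (0F , i) (1F , j))
    i~j = from (adj-rot-ref i j) (matched⇒linked (toℕ<n i) ij)
    unique : ∀ z → T (inM z) → T (cayAdj inC (0F , i) z) → z ≡ (1F , j)
    unique (0F , j') _ adj = ⊥-elim (nonadj-rot-rot i j' adj)
    unique (1F , j') j'∈M adj = cong (1F ,_) (toℕ-injective (matched-functional ij' ij))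
      where
      ij' : Matched (toℕ i) (toℕ j')
      ij' = linked⇒matched (toℕ<n i) (to (inM-rot i) i∈M) (to (inM-ref j') j'∈M)
                           (to (adj-rot-ref i j') adj)
  uniqueNeighbourInM (1F , j) j∈M with ref-partner (toℕ<n j) (to (inM-ref j) j∈M)
  ... | i , iM , ij = (0F , i) , (from (inM-rot i) iM , j~i) , unique
    where
    j~i : T (cayAdj inC (1F , j) (0F , i))
    j~i = from (adj-ref-rot i j) (matched⇒linked (toℕ<n i) ij)
    unique : ∀ z → T (inM z) → T (cayAdj inC (1F , j) z) → z ≡ (0F , i)
    unique (1F , i') _ adj = ⊥-elim (nonadj-ref-ref j i' adj)
    unique (0F , i') i'∈M adj = cong (0F ,_) (toℕ-injective (matched-injective i'j ij))
      where
      i'j : Matched (toℕ i') (toℕ j)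
      i'j = linked⇒matched (toℕ<n i') (to (inM-rot i') i'∈M) (to (inM-ref j) j∈M)
                           (to (adj-ref-rot i' j) adj)

module Vertices (d : ℕ) where
  open Thm d
  open Matching d
  open Adjacency d

  vertex : D → Fin (2 * n)
  vertex = uncurry combine

  vtx-combine : ∀ y → vtx (vertex y) ≡ y
  vtx-combine (e , i) = remQuot-combine e i

  combine-vtx : ∀ u → vertex (vtx u) ≡ u
  combine-vtx = combine-remQuot {2} n

  ∈-tabulate-vtx : ∀ (f : D → Bool) y → vertex y ∈ tabulate (f ∘ vtx) ⇔ T (f y)
  ∈-tabulate-vtx f y = subst (λ x → vertex y ∈ tabulate (f ∘ vtx) ⇔ T (f x)) (vtx-combine y) ∈-tabulate

  ∈M⇔ : ∀ {u} → u ∈ M ⇔ T (inM (vtx u))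
  ∈M⇔ = ∈-tabulate

  ∈nbhd⇔ : ∀ {u x} → x ∈ nbhd G u ⇔ T (G u x)
  ∈nbhd⇔ = ∈-tabulate

  rotPart refPart : Subset (2 * n) → Subset n
  rotPart K = tabulate (λ i → lookup K (vertex (0F , i)))
  refPart K = tabulate (λ i → lookup K (vertex (1F , i)))

  ∈-rotPart : ∀ {K i} → i ∈ rotPart K ⇔ vertex (0F , i) ∈ K
  ∈-rotPart = ⇔-sym ∈⇔T-lookup ⇔-∘ ∈-tabulate

  ∈-refPart : ∀ {K i} → i ∈ refPart K ⇔ vertex (1F , i) ∈ K
  ∈-refPart = ⇔-sym ∈⇔T-lookup ⇔-∘ ∈-tabulate

  -- Subset (2 * n) unfolds to Vec Bool (n + (n + 0)), so it is split twice.
  ∣K∣≡∣rotPart∣+∣refPart∣ : ∀ K → ∣ K ∣ ≡ ∣ rotPart K ∣ + ∣ refPart K ∣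
  ∣K∣≡∣rotPart∣+∣refPart∣ K = begin
    ∣ K ∣                         ≡⟨ ∣p∣≡∣p↑ˡ∣+∣p↑ʳ∣ n K ⟩
    ∣ rotPart K ∣ + ∣ K₁ ∣        ≡⟨ cong (∣ rotPart K ∣ +_) ∣K₁∣≡∣refPart∣ ⟩
    ∣ rotPart K ∣ + ∣ refPart K ∣ ∎
    where
    open ≡-Reasoning
    K₁ : Subset (n + 0)
    K₁ = tabulate (lookup K ∘ (n ↑ʳ_))
    ∣K₁∣≡∣refPart∣ : ∣ K₁ ∣ ≡ ∣ refPart K ∣
    ∣K₁∣≡∣refPart∣ = begin
      ∣ K₁ ∣                                 ≡⟨ ∣p∣≡∣p↑ˡ∣+∣p↑ʳ∣ n K₁ ⟩
      ∣ tabulate (lookup K₁ ∘ (_↑ˡ 0)) ∣ + 0 ≡⟨ +-identityʳ _ ⟩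
      ∣ tabulate (lookup K₁ ∘ (_↑ˡ 0)) ∣     ≡⟨ cong ∣_∣ (tabulate-cong (λ i → lookup∘tabulate (lookup K ∘ (n ↑ʳ_)) (i ↑ˡ 0))) ⟩
      ∣ refPart K ∣                          ∎

  pigeonhole : ∀ K → n < ∣ K ∣ → ∃[ i ] vertex (0F , i) ∈ K × vertex (1F , i) ∈ K
  pigeonhole K n<∣K∣ with 0<∣p∣⇒Nonempty 0<∣∩∣
    where
    0<∣∩∣ : 0 < ∣ rotPart K ∩ refPart K ∣
    0<∣∩∣ = +-cancelʳ-< n 0 _ (begin-strict
      n                                                        <⟨ n<∣K∣ ⟩
      ∣ K ∣                                                    ≡⟨ ∣K∣≡∣rotPart∣+∣refPart∣ K ⟩
      ∣ rotPart K ∣ + ∣ refPart K ∣                            ≡⟨ ∣p∣+∣q∣≡∣p∩q∣+∣p∪q∣ (rotPart K) (refPart K) ⟩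
      ∣ rotPart K ∩ refPart K ∣ + ∣ rotPart K ∪ refPart K ∣    ≤⟨ +-monoʳ-≤ _ (∣p∣≤n (rotPart K ∪ refPart K)) ⟩
      ∣ rotPart K ∩ refPart K ∣ + n                            ∎)
      where open ≤-Reasoning
  ... | i , i∈∩ with x∈p∩q⁻ (rotPart K) (refPart K) i∈∩
  ...   | i∈rot , i∈ref = i , to ∈-rotPart i∈rot , to ∈-refPart i∈ref

  aⁱ~aⁱb : ∀ i → T (G (vertex (0F , i)) (vertex (1F , i)))
  aⁱ~aⁱb i = subst₂ (λ x y → T (cayAdj inC x y)) (sym (vtx-combine (0F , i))) (sym (vtx-combine (1F , i)))
                    (from (adj-rot-ref i i) (linked-refl (toℕ<n i)))

  isRotation : D → Bool
  isRotation (0F , _) = true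
  isRotation (1F , _) = false

  rotations : Subset (2 * n)
  rotations = tabulate (isRotation ∘ vtx)

  ∈rotations⇔ : ∀ {u} → u ∈ rotations ⇔ T (isRotation (vtx u))
  ∈rotations⇔ = ∈-tabulate

  rotations-independent : Independent G rotations
  rotations-independent u v u∈R v∈R =
    ¬T⇒≡false (nonadj (vtx u) (vtx v) (to ∈rotations⇔ u∈R) (to ∈rotations⇔ v∈R))
    where
    nonadj : ∀ x y → T (isRotation x) → T (isRotation y) → ¬ T (cayAdj inC x y)
    nonadj (0F , i) (0F , j) _ _  = nonadj-rot-rot i j
    nonadj (0F , _) (1F , _) _ ()
    nonadj (1F , _) _        () _

  ∣rotations∣≡n : ∣ rotations ∣ ≡ n
  ∣rotations∣≡n = begin
    ∣ rotations ∣                                 ≡⟨ ∣K∣≡∣rotPart∣+∣refPart∣ rotations ⟩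
    ∣ rotPart rotations ∣ + ∣ refPart rotations ∣ ≡⟨ cong₂ (λ p q → ∣ p ∣ + ∣ q ∣) rotPart≡⊤ refPart≡⊥ ⟩
    ∣ ⊤ {n} ∣ + ∣ ⊥ {n} ∣                         ≡⟨ cong₂ _+_ (∣⊤∣≡n n) (∣⊥∣≡0 n) ⟩
    n + 0                                         ≡⟨ +-identityʳ n ⟩
    n                                             ∎
    where
    open ≡-Reasoning
    rotPart≡⊤ : rotPart rotations ≡ ⊤
    rotPart≡⊤ = ∀∈⇒≡⊤ (λ i → from ∈-rotPart (from (∈-tabulate-vtx isRotation (0F , i)) _))
    refPart≡⊥ : refPart rotations ≡ ⊥
    refPart≡⊥ = Empty-unique (λ (i , i∈) → to (∈-tabulate-vtx isRotation (1F , i)) (to ∈-refPart i∈))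

  independence-bound : ∀ S → Independent G S → ∣ S ∣ ≤ n
  independence-bound S S-independent = ≮⇒≥ λ n<∣S∣ →
    let i , a , b = pigeonhole S n<∣S∣ in subst T (S-independent _ _ a b) (aⁱ~aⁱb i)

  α≡n : IsIndependenceNumber G n
  α≡n = (rotations , rotations-independent , ∣rotations∣≡n) , independence-bound

  ∈-rotPart-M : ∀ {i} → i ∈ rotPart M ⇔ RotInM (toℕ i)
  ∈-rotPart-M {i} = inM-rot i ⇔-∘ (∈-tabulate-vtx inM (0F , i) ⇔-∘ ∈-rotPart)

  ∈-refPart-M : ∀ {i} → i ∈ refPart M ⇔ RefInM (toℕ i)
  ∈-refPart-M {i} = inM-ref i ⇔-∘ (∈-tabulate-vtx inM (1F , i) ⇔-∘ ∈-refPart)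

  origin : Fin n
  origin = fromℕ< (m^n>0 3 d)

  toℕ≡0⇒≡origin : ∀ {i} → toℕ i ≡ 0 → i ≡ origin
  toℕ≡0⇒≡origin i≡0 = toℕ-injective (trans i≡0 (sym (toℕ-fromℕ< _)))

  origin∈M : vertex (0F , origin) ∈ M
  origin∈M = from (∈-tabulate-vtx inM (0F , origin)) (from (inM-rot origin) (inj₁ (toℕ-fromℕ< _)))

  ∣M∣≡n+1 : ∣ M ∣ ≡ n + 1
  ∣M∣≡n+1 = begin
    ∣ M ∣                                         ≡⟨ ∣K∣≡∣rotPart∣+∣refPart∣ M ⟩
    ∣ rotPart M ∣ + ∣ refPart M ∣                 ≡⟨ ∣p∣+∣q∣≡∣p∩q∣+∣p∪q∣ (rotPart M) (refPart M) ⟩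
    ∣ rotPart M ∩ refPart M ∣ + ∣ rotPart M ∪ refPart M ∣ ≡⟨ cong₂ (λ p q → ∣ p ∣ + ∣ q ∣) ∩≡⁅origin⁆ ∪≡⊤ ⟩
    ∣ ⁅ origin ⁆ ∣ + ∣ ⊤ {n} ∣                    ≡⟨ cong₂ _+_ (∣⁅x⁆∣≡1 origin) (∣⊤∣≡n n) ⟩
    1 + n                                         ≡⟨ +-comm 1 n ⟩
    n + 1                                         ∎
    where
    open ≡-Reasoning
    origin∈∩ : origin ∈ rotPart M ∩ refPart M
    origin∈∩ = x∈p∩q⁺ (from ∈-rotPart-M (inj₁ (toℕ-fromℕ< _)) , from ∈-refPart-M (inj₁ (toℕ-fromℕ< _)))
    ∩≡⁅origin⁆ : rotPart M ∩ refPart M ≡ ⁅ origin ⁆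
    ∩≡⁅origin⁆ = ∈-unique⇒≡⁅x⁆ origin∈∩ λ i∈∩ →
      let i∈rot , i∈ref = x∈p∩q⁻ (rotPart M) (refPart M) i∈∩ in
      toℕ≡0⇒≡origin (RotInM×RefInM⇒≡0 (to ∈-rotPart-M i∈rot) (to ∈-refPart-M i∈ref))
    ∪≡⊤ : rotPart M ∪ refPart M ≡ ⊤
    ∪≡⊤ = ∀∈⇒≡⊤ λ i → x∈p∪q⁺ (Sum.map (from ∈-rotPart-M) (from ∈-refPart-M) (RotInM⊎RefInM (toℕ i)))

  M-degree : ∀ u → u ∈ M → degIn G M u ≡ 1
  M-degree u u∈M with uniqueNeighbourInM (vtx u) (to ∈M⇔ u∈M)
  ... | y , (y∈M , u~y) , unique = trans (cong ∣_∣ M∩N≡⁅w⁆) (∣⁅x⁆∣≡1 w)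
    where
    w : Fin (2 * n)
    w = vertex y
    w∈M∩N : w ∈ M ∩ nbhd G u
    w∈M∩N = x∈p∩q⁺ (from (∈-tabulate-vtx inM y) y∈M ,
                    from ∈nbhd⇔ (subst (T ∘ cayAdj inC (vtx u)) (sym (vtx-combine y)) u~y))
    M∩N≡⁅w⁆ : M ∩ nbhd G u ≡ ⁅ w ⁆
    M∩N≡⁅w⁆ = ∈-unique⇒≡⁅x⁆ w∈M∩N λ {x} x∈M∩N →
      let x∈M , u~x = x∈p∩q⁻ M (nbhd G u) x∈M∩N in
      trans (sym (combine-vtx x)) (cong vertex (unique (vtx x) (to ∈M⇔ x∈M) (to ∈nbhd⇔ u~x)))

  M-maxDegree : IsMaxDegIn G M 1
  M-maxDegree = (λ u u∈M → ≤-reflexive (M-degree u u∈M)) ,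
                inj₂ (vertex (0F , origin) , origin∈M , M-degree _ origin∈M)

  maxDegree≥1 : ∀ K t → n < ∣ K ∣ → IsMaxDegIn G K t → 1 ≤ t
  maxDegree≥1 K t n<∣K∣ (deg≤t , _) with pigeonhole K n<∣K∣
  ... | i , a , b = ≤-trans (x∈p⇒0<∣p∣ (x∈p∩q⁺ (b , from ∈nbhd⇔ (aⁱ~aⁱb i)))) (deg≤t _ a)

theorem2p1 : (d : ℕ) →
    (∣ Thm.M d ∣ ≡ 3 ^ d + 1) ×
    (∀ u → u ∈ Thm.M d → degIn (Thm.G d) (Thm.M d) u ≡ 1) ×
    IsSensitivity (Thm.G d) 1
theorem2p1 d = ∣M∣≡n+1 , M-degree , n , α≡n , (M , n<∣M∣ , M-maxDegree) , maxDegree≥1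
  where
  open Thm d using (n; M)
  open Vertices d
  n<∣M∣ : n < ∣ M ∣
  n<∣M∣ = subst (n <_) (sym ∣M∣≡n+1) (m<m+n n (s≤s z≤n))
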